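{- For all integers $k \geq 2$, $\nu_2(P_kQ_k - k) \geq 2$.
   Context: Pell sequence: $P_0=0$, $P_1=1$, $P_n=2P_{n-1}+P_{n-2}$ for $n\ge2$. Associated Pell sequence: $Q_0=1$, $Q_1=1$, $Q_n=2Q_{n-1}+Q_{n-2}$ for $n\ge2$. For a nonzero integer $m$, $\nu_2(m)$ is the exponent of the largest power of $2$ dividing $m$ (with $\nu_2(0)=\infty$). -}

module Defs where

open import Data.Nat using (ℕ; zero; suc; _+_; _*_)

P : ℕ → ℕ
P zero = 0
P (suc zero) = 1
P (suc (suc n)) = 2 * P (suc n) + P n

Q : ℕ → ℕ
Q zero = 1
Q (suc zero) = 1
Q (suc (suc n)) = 2 * Q (suc n) + Q n

{-# OPTIONS --safe #-}
-- Both Pell sequences satisfy u (n + 4) = u n + 4 (3 u (n + 1) + u n), so modulo 4 the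
-- pair (P k, Q k) has period 4 while k only gains 4.  Expanding the product then shows
-- that P k Q k - k changes by a multiple of 4 under k ↦ k + 4, and the four initial
-- values 0, 0, 4, 32 are divisible by 4.
module Submission where

open import Defs
open import Data.Nat using (ℕ; _≤_)
open import Data.Integer using (ℤ; +_; _-_; _*_)
open import Data.Integer.Divisibility using (_∣_)

import Data.Nat as ℕ
open import Data.Integer using (_+_)
open import Data.Integer.Properties using (pos-+; pos-*)
open import Data.Integer.Divisibility.Signed as Signed
  using (divides; ∣⇒∣ᵤ; ∣-refl; ∣m∣n⇒∣m+n; ∣m⇒∣m*n)
import Data.Nat.Tactic.RingSolver as ℕ-Ring
import Data.Integer.Tactic.RingSolver as ℤ-Ring
open import Relation.Binary.PropositionalEquality
open ≡-Reasoning

PellLike : (ℕ → ℕ) → Set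
PellLike u = ∀ n → u (2 ℕ.+ n) ≡ 2 ℕ.* u (1 ℕ.+ n) ℕ.+ u n

P-pellLike : PellLike P
P-pellLike _ = refl

Q-pellLike : PellLike Q
Q-pellLike _ = refl

pellLike-+4 : (u : ℕ → ℕ) → PellLike u → ∀ n →
              u (4 ℕ.+ n) ≡ u n ℕ.+ 4 ℕ.* (3 ℕ.* u (1 ℕ.+ n) ℕ.+ u n)
pellLike-+4 u rec n = begin
  u (4 ℕ.+ n)                                              ≡⟨ rec (2 ℕ.+ n) ⟩
  2 ℕ.* u (3 ℕ.+ n) ℕ.+ u (2 ℕ.+ n)                          ≡⟨ cong (λ t → 2 ℕ.* t ℕ.+ u (2 ℕ.+ n)) (rec (1 ℕ.+ n)) ⟩
  2 ℕ.* (2 ℕ.* u (2 ℕ.+ n) ℕ.+ a) ℕ.+ u (2 ℕ.+ n)            ≡⟨ cong (λ t → 2 ℕ.* (2 ℕ.* t ℕ.+ a) ℕ.+ t) (rec n) ⟩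
  2 ℕ.* (2 ℕ.* (2 ℕ.* a ℕ.+ b) ℕ.+ a) ℕ.+ (2 ℕ.* a ℕ.+ b)    ≡⟨ expand a b ⟩
  b ℕ.+ 4 ℕ.* (3 ℕ.* a ℕ.+ b)                                ∎
  where
  a = u (1 ℕ.+ n)
  b = u n
  expand : ∀ a b → 2 ℕ.* (2 ℕ.* (2 ℕ.* a ℕ.+ b) ℕ.+ a) ℕ.+ (2 ℕ.* a ℕ.+ b)
                   ≡ b ℕ.+ 4 ℕ.* (3 ℕ.* a ℕ.+ b)
  expand = ℕ-Ring.solve-∀

pos-m+d*n : ∀ m d n → + (m ℕ.+ d ℕ.* n) ≡ + m + + d * + n
pos-m+d*n m d n = trans (pos-+ m (d ℕ.* n)) (cong (_+_ (+ m)) (pos-* d n))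

∣pq-m⇒∣shifted : ∀ p q a b m → + 4 Signed.∣ p * q - m →
                 + 4 Signed.∣ (p + + 4 * a) * (q + + 4 * b) - (+ 4 + m)
∣pq-m⇒∣shifted p q a b m 4∣pq-m =
  subst (+ 4 Signed.∣_) (sym (expand p q a b m))
        (∣m∣n⇒∣m+n 4∣pq-m (∣m⇒∣m*n (a * q + p * b + + 4 * a * b - + 1) ∣-refl))
  where
  expand : ∀ p q a b m → (p + + 4 * a) * (q + + 4 * b) - (+ 4 + m)
           ≡ (p * q - m) + + 4 * (a * q + p * b + + 4 * a * b - + 1)
  expand = ℤ-Ring.solve-∀

4∣PQ-k : ∀ k → + 4 Signed.∣ + P k * + Q k - + k
4∣PQ-k 0 = divides (+ 0) refl
4∣PQ-k 1 = divides (+ 0) refl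
4∣PQ-k 2 = divides (+ 1) refl
4∣PQ-k 3 = divides (+ 8) refl
4∣PQ-k (ℕ.suc (ℕ.suc (ℕ.suc (ℕ.suc n)))) =
  subst (+ 4 Signed.∣_) (cong₂ (λ x y → x * y - + (4 ℕ.+ n)) P-shift Q-shift)
        (∣pq-m⇒∣shifted (+ P n) (+ Q n) (+ a) (+ b) (+ n) (4∣PQ-k n))
  where
  a = 3 ℕ.* P (1 ℕ.+ n) ℕ.+ P n
  b = 3 ℕ.* Q (1 ℕ.+ n) ℕ.+ Q n
  P-shift : + P n + + 4 * + a ≡ + P (4 ℕ.+ n)
  P-shift = sym (trans (cong +_ (pellLike-+4 P P-pellLike n)) (pos-m+d*n (P n) 4 a))
  Q-shift : + Q n + + 4 * + b ≡ + Q (4 ℕ.+ n)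
  Q-shift = sym (trans (cong +_ (pellLike-+4 Q Q-pellLike n)) (pos-m+d*n (Q n) 4 b))

lemma27 : (k : ℕ) → 2 ≤ k → (+ 4) ∣ ((+ P k) * (+ Q k) - (+ k))
lemma27 k _ = ∣⇒∣ᵤ (4∣PQ-k k)
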